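{- Let $k\geq 2$ be an integer. Suppose $D$ is a $\mathrm{DD}(m)$ having two difference vectors $\mathbf{d}$ and $\mathbf{d}'$ that are not parallel. Then $C_k(D)>km(m-1)$.
   Context: A $\mathrm{DD}(m)$ is a set $\{\mathbf{v}_1,\dots,\mathbf{v}_m\}$ of $m$ points of $\mathbb{Z}^2$ whose difference vectors $\mathbf{v}_i-\mathbf{v}_j$ ($i\ne j$) are all distinct. $C_k(D)$ (the $k$-hop coverage) is the number of non-zero vectors expressible as a sum of at most $k$ difference vectors of $D$. -}

module Defs where

open import Data.Nat using (ℕ)
open import Data.Integer using (ℤ; _+_; _-_; _*_; 0ℤ) renaming (_≟_ to _≟ℤ_)
open import Data.Product using (_×_; _,_; proj₁; proj₂)
open import Data.Product.Properties using (≡-dec)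
open import Data.Fin using (Fin)
open import Data.List using (List; []; _∷_; _++_; concatMap; map; filter; length; deduplicate; allFin)
open import Relation.Binary.PropositionalEquality using (_≡_; _≢_)
open import Relation.Nullary using (¬_; Dec)
open import Relation.Nullary.Decidable using (¬?)
open import Data.Fin using () renaming (_≟_ to _≟F_)

V2 : Set
V2 = ℤ × ℤ

_≟V_ : (u v : V2) → Dec (u ≡ v)
_≟V_ = ≡-dec _≟ℤ_ _≟ℤ_

_+V_ : V2 → V2 → V2
(a , b) +V (c , d) = (a + c , b + d)

_-V_ : V2 → V2 → V2
(a , b) -V (c , d) = (a - c , b - d)

0V : V2
0V = (0ℤ , 0ℤ)

Config : ℕ → Set
Config m = Fin m → V2

IsDD : {m : ℕ} → Config m → Set
IsDD {m} v = ∀ (i j i' j' : Fin m) → i ≢ j → i' ≢ j' →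
  (v i -V v j) ≡ (v i' -V v j') → (i ≡ i' × j ≡ j')

Parallel : V2 → V2 → Set
Parallel (a , b) (c , d) = a * d - b * c ≡ 0ℤ

HasNonParallelDiffs : {m : ℕ} → Config m → Set
HasNonParallelDiffs {m} v = Data.Product.∃ λ (i : Fin m) → Data.Product.∃ λ (j : Fin m) →
  Data.Product.∃ λ (i' : Fin m) → Data.Product.∃ λ (j' : Fin m) →
  i ≢ j × i' ≢ j' × ¬ Parallel (v i -V v j) (v i' -V v j')

diffs : {m : ℕ} → Config m → List V2
diffs {m} v = concatMap (λ i → concatMap (λ j → pick i j) (allFin m)) (allFin m)
  where
  pick : Fin m → Fin m → List V2
  pick i j with i ≟F j
  ... | Relation.Nullary.yes _ = []
  ... | Relation.Nullary.no _ = (v i -V v j) ∷ []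

sumsAtMost : List V2 → ℕ → List V2
sumsAtMost ds ℕ.zero = 0V ∷ []
sumsAtMost ds (ℕ.suc k) =
  sumsAtMost ds k ++ concatMap (λ d → map (d +V_) (sumsAtMost ds k)) ds

C : {m : ℕ} → ℕ → Config m → ℕ
C k v = length (deduplicate _≟V_ (filter (λ u → ¬? (u ≟V 0V)) (sumsAtMost (diffs v) k)))

-- Let ds be the m(m − 1) difference vectors: they are distinct, nonzero and closed under
-- negation.  The functional ψ(x , y) = (B + 1)x + y, where B bounds every |y|, vanishes on no
-- element of ds; let a ∈ ds maximise ψ, so p = ψ(a) > 0.  For s ∈ ds and j < k the tower
-- vector s + j·(±a), the sign being that of ψ(s), is a sum of j + 1 ≤ k differences, and ±ψ
-- of it is j·p + |ψ(s)| with |ψ(s)| ∈ (0, p]; hence these k·m(m − 1) vectors are nonzero and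
-- pairwise distinct.  The functional φ = det(a , ·) kills a, so it is constant along towers.
-- As two differences are not parallel, w ∈ ds maximising |φ| has φ(w) ≠ 0, and the vector
-- (k − 2)·a + 2w, a sum of k differences, has |φ| = 2|φ(w)|, exceeding |φ| of 0 and of every
-- tower vector: it is one more covered vector.

module Submission where

open import Defs
open import Algebra.Bundles using (AbelianGroup)
open import Data.Empty using (⊥-elim)
open import Data.Fin using (Fin) renaming (_≟_ to _≟F_)
open import Data.Integer as ℤ using (ℤ; +_; 0ℤ; 1ℤ; ∣_∣)
import Data.Integer.Properties as ℤₚ
open import Data.Integer.Tactic.RingSolver using (solve-∀)
open import Data.List using (List; []; _∷_; map; filter; concatMap; length; allFin; upTo)
open import Data.List.Properties
  using (length-++; length-map; length-upTo; length-tabulate; filter-all; filter-accept; filter-reject; filter-notAll)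
open import Data.List.Membership.Propositional using (_∈_; _∉_; lose; find)
open import Data.List.Membership.Propositional.Properties
  using ( ∈-map⁺; ∈-map⁻; ∈-filter⁺; ∈-filter⁻; ∈-concatMap⁺; ∈-concatMap⁻; ∈-++⁺ˡ; ∈-++⁺ʳ; ∈-++⁻
        ; ∈-allFin; ∈-upTo⁻; ∈-deduplicate⁺)
open import Data.List.Relation.Binary.Subset.Propositional using (_⊆_)
open import Data.List.Relation.Unary.All as All using (All)
import Data.List.Relation.Unary.All.Properties as Allₚ
import Data.List.Relation.Unary.Any as Any
open import Data.List.Relation.Unary.Any using (here; there)
open import Data.List.Relation.Unary.AllPairs using ([]; _∷_)
open import Data.List.Relation.Unary.Unique.Propositional using (Unique)
import Data.List.Relation.Unary.Unique.Propositional.Properties as Uniqueₚ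
open import Data.Nat using (ℕ; zero; suc; _+_; _*_; _∸_; _≤_; _<_; _≤′_; z≤n; s≤s)
import Data.Nat.Properties as ℕ
open import Data.Nat.GeneralisedArithmetic using (fold)
open import Data.Product using (∃; ∃₂; _×_; _,_; proj₁; proj₂)
open import Data.Sum using (_⊎_; inj₁; inj₂)
open import Function using (id; _∘_; _∋_; case_of_)
open import Relation.Binary.Bundles using (TotalOrder)
open import Relation.Binary.Definitions using (DecidableEquality)
open import Relation.Binary.PropositionalEquality
  using (_≡_; _≢_; refl; sym; trans; cong; cong₂; subst; subst₂; module ≡-Reasoning)
open import Relation.Nullary using (¬_; Dec; yes; no)
open import Relation.Nullary.Decidable using (¬?)

open import Algebra.Properties.Group (AbelianGroup.group ℤₚ.+-0-abelianGroup)
  using () renaming (∙-cancelˡ to +-cancelˡ)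

module _ {a} {A : Set a} where

  Unique-map⁺ : ∀ {b} {B : Set b} (f : A → B) {xs} → Unique xs →
                (∀ {x y} → x ∈ xs → y ∈ xs → f x ≡ f y → x ≡ y) → Unique (map f xs)
  Unique-map⁺ f {[]} [] _ = []
  Unique-map⁺ f {x ∷ xs} (x∉xs ∷ xs!) injective =
    Allₚ.map⁺ (All.tabulate λ y∈xs → All.lookup x∉xs y∈xs ∘ injective (here refl) (there y∈xs))
    ∷ Unique-map⁺ f xs! λ x∈ y∈ → injective (there x∈) (there y∈)

  Unique-concatMap⁺ : ∀ {b} {B : Set b} (f : A → List B) {xs} → Unique xs →
                      (∀ {x} → x ∈ xs → Unique (f x)) →
                      (∀ {x y z} → x ∈ xs → y ∈ xs → z ∈ f x → z ∈ f y → x ≡ y) →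
                      Unique (concatMap f xs)
  Unique-concatMap⁺ f {[]} [] _ _ = []
  Unique-concatMap⁺ f {x ∷ xs} (x∉xs ∷ xs!) f! disjoint =
    Uniqueₚ.++⁺ (f! (here refl))
      (Unique-concatMap⁺ f xs! (f! ∘ there) λ x∈ y∈ → disjoint (there x∈) (there y∈))
      λ (z∈fx , z∈rest) → let y , y∈xs , z∈fy = find (∈-concatMap⁻ f z∈rest) in
        All.lookup x∉xs y∈xs (disjoint (here refl) (there y∈xs) z∈fx z∈fy)

  length-concatMap-const : ∀ {b} {B : Set b} (f : A → List B) {n} → (∀ x → length (f x) ≡ n) →
                           ∀ xs → length (concatMap f xs) ≡ length xs * n
  length-concatMap-const f |f|≡n [] = refl
  length-concatMap-const f |f|≡n (x ∷ xs) =
    trans (length-++ (f x)) (cong₂ _+_ (|f|≡n x) (length-concatMap-const f |f|≡n xs))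

  ∈-concatMap²⁺ : ∀ {b c} {B : Set b} {C : Set c} {f : A → B → List C} {xs ys x y z} →
                  x ∈ xs → y ∈ ys → z ∈ f x y → z ∈ concatMap (λ x → concatMap (f x) ys) xs
  ∈-concatMap²⁺ x∈xs y∈ys z∈fxy = ∈-concatMap⁺ _ (lose x∈xs (∈-concatMap⁺ _ (lose y∈ys z∈fxy)))

module _ {a} {A : Set a} (_≟_ : DecidableEquality A) where

  Unique∧⊆⇒length≤ : ∀ {xs ys} → Unique xs → xs ⊆ ys → length xs ≤ length ys
  Unique∧⊆⇒length≤ {[]} _ _ = z≤n
  Unique∧⊆⇒length≤ {x ∷ xs} {ys} (x∉xs ∷ xs!) x∷xs⊆ys =
    ℕ.≤-trans (s≤s (Unique∧⊆⇒length≤ xs! xs⊆ys∖x))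
              (filter-notAll ≢x? ys (Any.map (λ x≡y y≢x → y≢x (sym x≡y)) (x∷xs⊆ys (here refl))))
    where
    ≢x? : ∀ y → Dec (y ≢ x)
    ≢x? y = ¬? (y ≟ x)
    xs⊆ys∖x : xs ⊆ filter ≢x? ys
    xs⊆ys∖x z∈xs = ∈-filter⁺ ≢x? (x∷xs⊆ys (there z∈xs)) λ z≡x → All.lookup x∉xs z∈xs (sym z≡x)

  length-filter-≢ : ∀ {x xs} → Unique xs → x ∈ xs →
                    suc (length (filter (λ y → ¬? (x ≟ y)) xs)) ≡ length xs
  length-filter-≢ {x} {_ ∷ xs} (x∉xs ∷ _) (here refl) =
    cong (suc ∘ length) (trans (filter-reject ≢? {xs = xs} λ x≢x → x≢x refl) (filter-all ≢? x∉xs))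
    where
    ≢? : ∀ y → Dec (x ≢ y)
    ≢? y = ¬? (x ≟ y)
  length-filter-≢ {x} {y ∷ xs} (y∉xs ∷ xs!) (there x∈xs) =
    cong suc (trans (cong length (filter-accept ≢? {y} {xs} λ x≡y → All.lookup y∉xs x∈xs (sym x≡y)))
                    (length-filter-≢ xs! x∈xs))
    where
    ≢? : ∀ y → Dec (x ≢ y)
    ≢? y = ¬? (x ≟ y)

module _ {b ℓ₁ ℓ₂} (O : TotalOrder b ℓ₁ ℓ₂) where
  open TotalOrder O renaming (Carrier to B; _≤_ to _≼_)
  open import Data.List.Extrema O using (argmax; f[xs]≤f[argmax]; argmax-all)

  maximiser : ∀ {a} {A : Set a} (f : A → B) {x : A} {xs : List A} → x ∈ xs →
              ∃ λ y → y ∈ xs × (∀ {z} → z ∈ xs → f z ≼ f y)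
  maximiser f {x} {xs} x∈xs =
    argmax f x xs ,
    argmax-all f {P = _∈ xs} x∈xs (All.tabulate id) ,
    All.lookup (f[xs]≤f[argmax] {f = f} x xs)

-- Vectors of ℤ² and linear functionals

negV : V2 → V2
negV (x , y) = ℤ.- x , ℤ.- y

negV-−V : ∀ u v → negV (u -V v) ≡ v -V u
negV-−V (x , y) (x′ , y′) = cong₂ _,_ (neg-minus x x′) (neg-minus y y′)
  where
  neg-minus : ∀ i j → ℤ.- (i ℤ.- j) ≡ j ℤ.- i
  neg-minus = solve-∀

+V-identityʳ : ∀ u → u +V 0V ≡ u
+V-identityʳ (x , y) = cong₂ _,_ (ℤₚ.+-identityʳ x) (ℤₚ.+-identityʳ y)

+V-cancelˡ : ∀ c {u v} → c +V u ≡ c +V v → u ≡ v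
+V-cancelˡ (x , y) {_ , _} {_ , _} eq =
  cong₂ _,_ (+-cancelˡ x _ _ (cong proj₁ eq)) (+-cancelˡ y _ _ (cong proj₂ eq))

infix 7 _·_
_·_ : V2 → V2 → ℤ
(a , b) · (x , y) = a ℤ.* x ℤ.+ b ℤ.* y

·-distribˡ-+V : ∀ u v w → u · (v +V w) ≡ u · v ℤ.+ u · w
·-distribˡ-+V (a , b) (x , y) (x′ , y′) = identity a b x y x′ y′
  where
  identity : ∀ a b x y x′ y′ → a ℤ.* (x ℤ.+ x′) ℤ.+ b ℤ.* (y ℤ.+ y′) ≡
                                (a ℤ.* x ℤ.+ b ℤ.* y) ℤ.+ (a ℤ.* x′ ℤ.+ b ℤ.* y′)
  identity = solve-∀

·-zeroʳ : ∀ u → u · 0V ≡ 0ℤ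
·-zeroʳ (a , b) = cong₂ ℤ._+_ (ℤₚ.*-zeroʳ a) (ℤₚ.*-zeroʳ b)

·-negV : ∀ u v → u · negV v ≡ ℤ.- (u · v)
·-negV (a , b) (x , y) = identity a b x y
  where
  identity : ∀ a b x y → a ℤ.* ℤ.- x ℤ.+ b ℤ.* ℤ.- y ≡ ℤ.- (a ℤ.* x ℤ.+ b ℤ.* y)
  identity = solve-∀

module _ {a b} {A : Set a} {B : Set b} (_∙_ : A → A → A) (_◦_ : B → B → B) where

  fold-hom : (f : A → B) → (∀ x y → f (x ∙ y) ≡ f x ◦ f y) →
             ∀ j c x → f (fold x (c ∙_) j) ≡ fold (f x) (f c ◦_) j
  fold-hom f hom zero c x = refl
  fold-hom f hom (suc j) c x = trans (hom c _) (cong (f c ◦_) (fold-hom f hom j c x))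

translate : ℕ → V2 → V2 → V2
translate j c s = fold s (c +V_) j

·-translate : ∀ u j c s → u · translate j c s ≡ fold (u · s) (ℤ._+_ (u · c)) j
·-translate u = fold-hom _+V_ ℤ._+_ (u ·_) (·-distribˡ-+V u)

translate-cancel : ∀ j c {s t} → translate j c s ≡ translate j c t → s ≡ t
translate-cancel zero c eq = eq
translate-cancel (suc j) c eq = translate-cancel j c (+V-cancelˡ c eq)

translate-injective : ∀ {j j′ c s t} → translate j c s ≡ translate j′ c t → j ≡ j′ → j ≡ j′ × s ≡ t
translate-injective {j} {c = c} eq refl = refl , translate-cancel j c eq

∣i+i∣≡∣i∣+∣i∣ : ∀ i → ∣ i ℤ.+ i ∣ ≡ ∣ i ∣ + ∣ i ∣
∣i+i∣≡∣i∣+∣i∣ (+ n) = refl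
∣i+i∣≡∣i∣+∣i∣ ℤ.-[1+ n ] = cong suc (sym (ℕ.+-suc n n))

0<i⇒-i≮0 : ∀ {i} → 0ℤ ℤ.< i → ¬ 0ℤ ℤ.< ℤ.- i
0<i⇒-i≮0 {+ zero} (ℤ.+<+ ())
0<i⇒-i≮0 {+ suc _} _ ()

fold-+-identity : ∀ j x → fold x (ℤ._+_ 0ℤ) j ≡ x
fold-+-identity zero x = refl
fold-+-identity (suc j) x = trans (ℤₚ.+-identityˡ _) (fold-+-identity j x)

0<fold-+ : ∀ {p x} j → 0ℤ ℤ.≤ p → 0ℤ ℤ.< x → 0ℤ ℤ.< fold x (ℤ._+_ p) j
0<fold-+ zero 0≤p 0<x = 0<x
0<fold-+ (suc j) 0≤p 0<x = ℤₚ.+-mono-≤-< 0≤p (0<fold-+ j 0≤p 0<x)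

fold-+-injective : ∀ {p x y} j j′ → 0ℤ ℤ.< x → x ℤ.≤ p → 0ℤ ℤ.< y → y ℤ.≤ p →
                   fold x (ℤ._+_ p) j ≡ fold y (ℤ._+_ p) j′ → j ≡ j′
fold-+-injective zero zero _ _ _ _ _ = refl
fold-+-injective {p} {x} {y} zero (suc j′) 0<x x≤p 0<y y≤p x≡p+z = ⊥-elim (ℤₚ.<⇒≱ p<x x≤p)
  where
  p<x : p ℤ.< x
  p<x = subst₂ ℤ._<_ (ℤₚ.+-identityʳ p) (sym x≡p+z)
          (ℤₚ.+-monoʳ-< p (0<fold-+ j′ (ℤₚ.<⇒≤ (ℤₚ.<-≤-trans 0<y y≤p)) 0<y))
fold-+-injective (suc j) zero 0<x x≤p 0<y y≤p eq =
  sym (fold-+-injective zero (suc j) 0<y y≤p 0<x x≤p (sym eq))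
fold-+-injective {p} (suc j) (suc j′) 0<x x≤p 0<y y≤p eq =
  cong suc (fold-+-injective j j′ 0<x x≤p 0<y y≤p (+-cancelˡ p _ _ eq))

perp : V2 → V2
perp (x , y) = ℤ.- y , x

perp-·-self : ∀ u → perp u · u ≡ 0ℤ
perp-·-self (x , y) = identity x y
  where
  identity : ∀ x y → ℤ.- y ℤ.* x ℤ.+ x ℤ.* y ≡ 0ℤ
  identity = solve-∀

perp·≡0⇒Parallel : ∀ {u} d e → u ≢ 0V → perp u · d ≡ 0ℤ → perp u · e ≡ 0ℤ → Parallel d e
perp·≡0⇒Parallel {u₁ , u₂} (d₁ , d₂) (e₁ , e₂) u≢0 ud≡0 ue≡0 =
  det≡0 (ℤₚ.i*j≡0⇒i≡0∨j≡0 u₁ (vanishes u₁ d₁ e₁ (identity₁ u₁ u₂ d₁ d₂ e₁ e₂)))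
        (ℤₚ.i*j≡0⇒i≡0∨j≡0 u₂ (vanishes u₂ d₂ e₂ (identity₂ u₁ u₂ d₁ d₂ e₁ e₂)))
  where
  det ud ue : ℤ
  det = d₁ ℤ.* e₂ ℤ.- d₂ ℤ.* e₁
  ud = ℤ.- u₂ ℤ.* d₁ ℤ.+ u₁ ℤ.* d₂
  ue = ℤ.- u₂ ℤ.* e₁ ℤ.+ u₁ ℤ.* e₂
  identity₁ : ∀ u₁ u₂ d₁ d₂ e₁ e₂ →
              u₁ ℤ.* (d₁ ℤ.* e₂ ℤ.- d₂ ℤ.* e₁) ≡
              d₁ ℤ.* (ℤ.- u₂ ℤ.* e₁ ℤ.+ u₁ ℤ.* e₂) ℤ.- e₁ ℤ.* (ℤ.- u₂ ℤ.* d₁ ℤ.+ u₁ ℤ.* d₂)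
  identity₁ = solve-∀
  identity₂ : ∀ u₁ u₂ d₁ d₂ e₁ e₂ →
              u₂ ℤ.* (d₁ ℤ.* e₂ ℤ.- d₂ ℤ.* e₁) ≡
              d₂ ℤ.* (ℤ.- u₂ ℤ.* e₁ ℤ.+ u₁ ℤ.* e₂) ℤ.- e₂ ℤ.* (ℤ.- u₂ ℤ.* d₁ ℤ.+ u₁ ℤ.* d₂)
  identity₂ = solve-∀
  vanishes : ∀ c dc ec → c ℤ.* det ≡ dc ℤ.* ue ℤ.- ec ℤ.* ud → c ℤ.* det ≡ 0ℤ
  vanishes _ dc ec eq = trans eq (trans (cong₂ (λ s t → dc ℤ.* s ℤ.- ec ℤ.* t) ue≡0 ud≡0)
                                      (cong₂ ℤ._-_ (ℤₚ.*-zeroʳ dc) (ℤₚ.*-zeroʳ ec)))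
  det≡0 : u₁ ≡ 0ℤ ⊎ det ≡ 0ℤ → u₂ ≡ 0ℤ ⊎ det ≡ 0ℤ → det ≡ 0ℤ
  det≡0 (inj₂ det≡0) _ = det≡0
  det≡0 (inj₁ _) (inj₂ det≡0) = det≡0
  det≡0 (inj₁ u₁≡0) (inj₁ u₂≡0) = ⊥-elim (u≢0 (cong₂ _,_ u₁≡0 u₂≡0))

steep : ℕ → V2
steep B = + suc B , 1ℤ

steep·≢0 : ∀ {B} s → ∣ proj₂ s ∣ ≤ B → s ≢ 0V → steep B · s ≢ 0ℤ
steep·≢0 {B} (x , y) ∣y∣≤B s≢0 ψs≡0 = s≢0 (cong₂ _,_ x≡0 y≡0)
  where
  y≡-Bx : y ≡ ℤ.- (+ suc B ℤ.* x)
  y≡-Bx = trans (identity (+ suc B) x y)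
                (trans (cong (ℤ._- (+ suc B ℤ.* x)) ψs≡0) (ℤₚ.+-identityˡ _))
    where
    identity : ∀ b x y → y ≡ (b ℤ.* x ℤ.+ 1ℤ ℤ.* y) ℤ.- b ℤ.* x
    identity = solve-∀
  ∣y∣≡ : ∣ y ∣ ≡ suc B * ∣ x ∣
  ∣y∣≡ = trans (cong ∣_∣ y≡-Bx) (trans (ℤₚ.∣-i∣≡∣i∣ (+ suc B ℤ.* x)) (ℤₚ.abs-* (+ suc B) x))
  vanishing : ∀ n → suc B * n ≤ B → n ≡ 0
  vanishing zero _ = refl
  vanishing (suc n) le = ⊥-elim (ℕ.<-irrefl refl (ℕ.≤-trans (ℕ.m≤m*n (suc B) (suc n)) le))
  ∣x∣≡0 : ∣ x ∣ ≡ 0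
  ∣x∣≡0 = vanishing ∣ x ∣ (subst (_≤ B) ∣y∣≡ ∣y∣≤B)
  x≡0 : x ≡ 0ℤ
  x≡0 = ℤₚ.∣i∣≡0⇒i≡0 ∣x∣≡0
  y≡0 : y ≡ 0ℤ
  y≡0 = ℤₚ.∣i∣≡0⇒i≡0 (trans ∣y∣≡ (trans (cong (suc B *_) ∣x∣≡0) (ℕ.*-zeroʳ (suc B))))

-- Sums of at most r vectors

module _ (ds : List V2) where

  sumsAtMost-step : ∀ {r x d} → x ∈ sumsAtMost ds r → d ∈ ds → d +V x ∈ sumsAtMost ds (suc r)
  sumsAtMost-step {r} x∈ d∈ds =
    ∈-++⁺ʳ (sumsAtMost ds r) (∈-concatMap⁺ _ (Any.map (λ { refl → ∈-map⁺ _ x∈ }) d∈ds))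

  sumsAtMost-1 : ∀ {d} → d ∈ ds → d ∈ sumsAtMost ds 1
  sumsAtMost-1 {d} d∈ds =
    subst (_∈ sumsAtMost ds 1) (+V-identityʳ d) (sumsAtMost-step {0} (here refl) d∈ds)

  sumsAtMost-mono : ∀ {r r′ x} → r ≤ r′ → x ∈ sumsAtMost ds r → x ∈ sumsAtMost ds r′
  sumsAtMost-mono r≤r′ = mono′ (ℕ.≤⇒≤′ r≤r′)
    where
    mono′ : ∀ {r r′ x} → r ≤′ r′ → x ∈ sumsAtMost ds r → x ∈ sumsAtMost ds r′
    mono′ Data.Nat.≤′-refl = id
    mono′ (Data.Nat.≤′-step r≤′r′) = ∈-++⁺ˡ ∘ mono′ r≤′r′

  sumsAtMost-translate : ∀ j {c r x} → c ∈ ds → x ∈ sumsAtMost ds r →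
                         translate j c x ∈ sumsAtMost ds (j + r)
  sumsAtMost-translate zero _ x∈ = x∈
  sumsAtMost-translate (suc j) {r = r} c∈ds x∈ =
    sumsAtMost-step {j + r} (sumsAtMost-translate j c∈ds x∈) c∈ds

sumsAtMost-⊆ : ∀ {ds es} r → ds ⊆ es → sumsAtMost ds r ⊆ sumsAtMost es r
sumsAtMost-⊆ zero _ x∈ = x∈
sumsAtMost-⊆ {ds} {es} (suc r) ds⊆es x∈ with ∈-++⁻ (sumsAtMost ds r) x∈
... | inj₁ x∈S = ∈-++⁺ˡ (sumsAtMost-⊆ r ds⊆es x∈S)
... | inj₂ x∈S′ with find (∈-concatMap⁻ (λ d → map (d +V_) (sumsAtMost ds r)) {ds} x∈S′)
...   | d , d∈ds , x∈d+S with ∈-map⁻ (d +V_) x∈d+S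
...     | y , y∈S , refl = sumsAtMost-step es {r} (sumsAtMost-⊆ r ds⊆es y∈S) (ds⊆es d∈ds)

-- Difference vectors of a configuration

module _ {m} (v : Config m) where

  -- `diffs` selects pairs through a helper local to its definition, which cannot be named
  -- here; `with` abstracts `i ≟F j` in the type of the embedding and so unfolds that helper.
  ∈-diffs⁺ : ∀ {i j} → i ≢ j → v i -V v j ∈ diffs v
  ∈-diffs⁺ {i} {j} i≢j
    with i ≟F j | (∀ {x} → x ∈ _ → x ∈ diffs v) ∋ ∈-concatMap²⁺ (∈-allFin i) (∈-allFin j)
  ... | yes i≡j | _ = ⊥-elim (i≢j i≡j)
  ... | no _ | embed = embed (here refl)

  others : Fin m → List (Fin m)
  others i = filter (λ j → ¬? (i ≟F j)) (allFin m)

  ∈-others⁻ : ∀ {i j} → j ∈ others i → i ≢ j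
  ∈-others⁻ {i} j∈ = proj₂ (∈-filter⁻ (λ j → ¬? (i ≟F j)) {xs = allFin m} j∈)

  differencesFrom : Fin m → List V2
  differencesFrom i = map (λ j → v i -V v j) (others i)

  differences : List V2
  differences = concatMap differencesFrom (allFin m)

  ∈-differencesFrom⁻ : ∀ {i x} → x ∈ differencesFrom i → ∃ λ j → i ≢ j × x ≡ v i -V v j
  ∈-differencesFrom⁻ {i} x∈ with ∈-map⁻ _ x∈
  ... | j , j∈ , x≡ = j , ∈-others⁻ j∈ , x≡

  ∈-differences⁻ : ∀ {x} → x ∈ differences → ∃₂ λ i j → i ≢ j × x ≡ v i -V v j
  ∈-differences⁻ x∈ with find (∈-concatMap⁻ differencesFrom {allFin m} x∈)
  ... | i , _ , x∈row = i , ∈-differencesFrom⁻ x∈row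

  ∈-differences⁺ : ∀ {i j} → i ≢ j → v i -V v j ∈ differences
  ∈-differences⁺ {i} {j} i≢j =
    ∈-concatMap⁺ differencesFrom
      (lose (∈-allFin i) (∈-map⁺ _ (∈-filter⁺ (λ j → ¬? (i ≟F j)) (∈-allFin j) i≢j)))

  differences⊆diffs : differences ⊆ diffs v
  differences⊆diffs x∈ with ∈-differences⁻ x∈
  ... | i , j , i≢j , refl = ∈-diffs⁺ i≢j

  differences-negV : ∀ {x} → x ∈ differences → negV x ∈ differences
  differences-negV x∈ with ∈-differences⁻ x∈
  ... | i , j , i≢j , refl rewrite negV-−V (v i) (v j) = ∈-differences⁺ (i≢j ∘ sym)

  length-differences : length differences ≡ m * (m ∸ 1)
  length-differences =
    trans (length-concatMap-const differencesFrom length-differencesFrom (allFin m))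
          (cong (_* (m ∸ 1)) (length-tabulate {n = m} id))
    where
    length-differencesFrom : ∀ i → length (differencesFrom i) ≡ m ∸ 1
    length-differencesFrom i =
      trans (length-map (λ j → v i -V v j) (others i))
            (cong (_∸ 1) (trans (length-filter-≢ _≟F_ (Uniqueₚ.allFin⁺ m) (∈-allFin i))
                                (length-tabulate {n = m} id)))

  module _ (dd : IsDD v) where

    0∉differences : 0V ∉ differences
    0∉differences 0∈ with ∈-differences⁻ 0∈
    ... | i , j , i≢j , 0≡vi-vj = i≢j (proj₁ (dd i j j i i≢j (i≢j ∘ sym) vi-vj≡vj-vi))
      where
      open ≡-Reasoning
      vi-vj≡vj-vi : v i -V v j ≡ v j -V v i
      vi-vj≡vj-vi = begin
        v i -V v j          ≡⟨ sym 0≡vi-vj ⟩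
        0V                  ≡⟨ cong negV 0≡vi-vj ⟩
        negV (v i -V v j)   ≡⟨ negV-−V (v i) (v j) ⟩
        v j -V v i          ∎

    differences-unique : Unique differences
    differences-unique =
      Unique-concatMap⁺ differencesFrom (Uniqueₚ.allFin⁺ m) (λ _ → row-unique) rows-disjoint
      where
      row-unique : ∀ {i} → Unique (differencesFrom i)
      row-unique {i} = Unique-map⁺ _ (Uniqueₚ.filter⁺ (λ j → ¬? (i ≟F j)) (Uniqueₚ.allFin⁺ m))
        λ j∈ j′∈ eq → proj₂ (dd i _ i _ (∈-others⁻ j∈) (∈-others⁻ j′∈) eq)
      rows-disjoint : ∀ {i i′ x} → i ∈ allFin m → i′ ∈ allFin m →
                      x ∈ differencesFrom i → x ∈ differencesFrom i′ → i ≡ i′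
      rows-disjoint _ _ x∈ x∈′ with ∈-differencesFrom⁻ x∈ | ∈-differencesFrom⁻ x∈′
      ... | j , i≢j , refl | j′ , i′≢j′ , eq = proj₁ (dd _ j _ j′ i≢j i′≢j′ eq)

-- Towers over the differences and one extra vector

CoveredBy : List V2 → ℕ → V2 → Set
CoveredBy ds k u = u ∈ sumsAtMost ds k × u ≢ 0V

module Coverage (ds : List V2) (ds! : Unique ds) (0∉ds : 0V ∉ ds)
                (ds-negV : ∀ {d} → d ∈ ds → negV d ∈ ds)
                {d e : V2} (d∈ds : d ∈ ds) (e∈ds : e ∈ ds) (d∦e : ¬ Parallel d e) where

  opaque
    B : ℕ
    B = ∣ proj₂ (proj₁ (maximiser ℕ.≤-totalOrder (∣_∣ ∘ proj₂) d∈ds)) ∣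

    ∣proj₂∣≤B : ∀ {s} → s ∈ ds → ∣ proj₂ s ∣ ≤ B
    ∣proj₂∣≤B = proj₂ (proj₂ (maximiser ℕ.≤-totalOrder (∣_∣ ∘ proj₂) d∈ds))

  ψ : V2 → ℤ
  ψ = steep B ·_

  ψ0≡0 : ψ 0V ≡ 0ℤ
  ψ0≡0 = ·-zeroʳ (steep B)

  ψ≢0 : ∀ {s} → s ∈ ds → ψ s ≢ 0ℤ
  ψ≢0 {s} s∈ds = steep·≢0 s (∣proj₂∣≤B s∈ds) λ s≡0 → 0∉ds (subst (_∈ ds) s≡0 s∈ds)

  0<-ψ : ∀ {s} → s ∈ ds → ¬ 0ℤ ℤ.< ψ s → 0ℤ ℤ.< ℤ.- ψ s
  0<-ψ s∈ds ψs≯0 = ℤₚ.neg-mono-< (ℤₚ.≤∧≢⇒< (ℤₚ.≮⇒≥ ψs≯0) (ψ≢0 s∈ds))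

  opaque
    a : V2
    a = proj₁ (maximiser ℤₚ.≤-totalOrder ψ d∈ds)

    a∈ds : a ∈ ds
    a∈ds = proj₁ (proj₂ (maximiser ℤₚ.≤-totalOrder ψ d∈ds))

    ψ≤ψa : ∀ {s} → s ∈ ds → ψ s ℤ.≤ ψ a
    ψ≤ψa = proj₂ (proj₂ (maximiser ℤₚ.≤-totalOrder ψ d∈ds))

  p : ℤ
  p = ψ a

  -ψ≤p : ∀ {s} → s ∈ ds → ℤ.- ψ s ℤ.≤ p
  -ψ≤p {s} s∈ds = subst (ℤ._≤ p) (·-negV (steep B) s) (ψ≤ψa (ds-negV s∈ds))

  0<p : 0ℤ ℤ.< p
  0<p with 0ℤ ℤ.<? ψ d
  ... | yes 0<ψd = ℤₚ.<-≤-trans 0<ψd (ψ≤ψa d∈ds)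
  ... | no ψd≯0 = ℤₚ.<-≤-trans (0<-ψ d∈ds ψd≯0) (-ψ≤p d∈ds)

  a≢0 : a ≢ 0V
  a≢0 a≡0 = 0∉ds (subst (_∈ ds) a≡0 a∈ds)

  towerStep : (s : V2) → Dec (0ℤ ℤ.< ψ s) → V2
  towerStep _ (yes _) = a
  towerStep _ (no _) = negV a

  towerStep∈ds : ∀ s σ → towerStep s σ ∈ ds
  towerStep∈ds _ (yes _) = a∈ds
  towerStep∈ds _ (no _) = ds-negV a∈ds

  tower : ℕ → V2 → V2
  tower j s = translate j (towerStep s (0ℤ ℤ.<? ψ s)) s

  ψ-translate-a : ∀ j s → ψ (translate j a s) ≡ fold (ψ s) (ℤ._+_ p) j
  ψ-translate-a j s = ·-translate (steep B) j a s

  -ψ-translate-negV-a : ∀ j s → ℤ.- ψ (translate j (negV a) s) ≡ fold (ℤ.- ψ s) (ℤ._+_ p) j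
  -ψ-translate-negV-a j s = begin
    ℤ.- ψ (translate j (negV a) s)
      ≡⟨ cong ℤ.-_ (·-translate (steep B) j (negV a) s) ⟩
    ℤ.- fold (ψ s) (ℤ._+_ (ψ (negV a))) j
      ≡⟨ fold-hom ℤ._+_ ℤ._+_ ℤ.-_ ℤₚ.neg-distrib-+ j (ψ (negV a)) (ψ s) ⟩
    fold (ℤ.- ψ s) (ℤ._+_ (ℤ.- ψ (negV a))) j
      ≡⟨ cong (λ c → fold (ℤ.- ψ s) (ℤ._+_ c) j) -ψ[-a]≡p ⟩
    fold (ℤ.- ψ s) (ℤ._+_ p) j
      ∎
    where
    open ≡-Reasoning
    -ψ[-a]≡p : ℤ.- ψ (negV a) ≡ p
    -ψ[-a]≡p = trans (cong ℤ.-_ (·-negV (steep B) a)) (ℤₚ.neg-involutive p)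

  0<ψ-translate-a : ∀ j {s} → 0ℤ ℤ.< ψ s → 0ℤ ℤ.< ψ (translate j a s)
  0<ψ-translate-a j {s} 0<ψs =
    subst (0ℤ ℤ.<_) (sym (ψ-translate-a j s)) (0<fold-+ j (ℤₚ.<⇒≤ 0<p) 0<ψs)

  0<-ψ-translate-negV-a : ∀ j {s} → s ∈ ds → ¬ 0ℤ ℤ.< ψ s → 0ℤ ℤ.< ℤ.- ψ (translate j (negV a) s)
  0<-ψ-translate-negV-a j {s} s∈ds ψs≯0 =
    subst (0ℤ ℤ.<_) (sym (-ψ-translate-negV-a j s)) (0<fold-+ j (ℤₚ.<⇒≤ 0<p) (0<-ψ s∈ds ψs≯0))

  tower-nonzero : ∀ j {s} → s ∈ ds → tower j s ≢ 0V
  tower-nonzero j {s} s∈ds t≡0 with 0ℤ ℤ.<? ψ s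
  ... | yes 0<ψs = ℤₚ.<-irrefl (sym (trans (cong ψ t≡0) ψ0≡0)) (0<ψ-translate-a j 0<ψs)
  ... | no ψs≯0 =
    ℤₚ.<-irrefl (sym (trans (cong (ℤ.-_ ∘ ψ) t≡0) (cong ℤ.-_ ψ0≡0))) (0<-ψ-translate-negV-a j s∈ds ψs≯0)


  tower-injective : ∀ {j j′ s t} → s ∈ ds → t ∈ ds → tower j s ≡ tower j′ t → j ≡ j′ × s ≡ t
  tower-injective {j} {j′} {s} {t} s∈ds t∈ds eq with 0ℤ ℤ.<? ψ s | 0ℤ ℤ.<? ψ t
  ... | yes 0<ψs | yes 0<ψt = translate-injective {c = a} eq
    (fold-+-injective j j′ 0<ψs (ψ≤ψa s∈ds) 0<ψt (ψ≤ψa t∈ds)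
      (trans (sym (ψ-translate-a j s)) (trans (cong ψ eq) (ψ-translate-a j′ t))))
  ... | no ψs≯0 | no ψt≯0 = translate-injective {c = negV a} eq
    (fold-+-injective j j′ (0<-ψ s∈ds ψs≯0) (-ψ≤p s∈ds) (0<-ψ t∈ds ψt≯0) (-ψ≤p t∈ds)
      (trans (sym (-ψ-translate-negV-a j s)) (trans (cong (ℤ.-_ ∘ ψ) eq) (-ψ-translate-negV-a j′ t))))
  ... | yes 0<ψs | no ψt≯0 = ⊥-elim (0<i⇒-i≮0 (0<ψ-translate-a j 0<ψs)
    (subst (λ u → 0ℤ ℤ.< ℤ.- ψ u) (sym eq) (0<-ψ-translate-negV-a j′ t∈ds ψt≯0)))
  ... | no ψs≯0 | yes 0<ψt = ⊥-elim (0<i⇒-i≮0 (0<ψ-translate-a j′ 0<ψt)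
    (subst (λ u → 0ℤ ℤ.< ℤ.- ψ u) eq (0<-ψ-translate-negV-a j s∈ds ψs≯0)))

  tower∈sums : ∀ j {s} → s ∈ ds → tower j s ∈ sumsAtMost ds (j + 1)
  tower∈sums j {s} s∈ds =
    sumsAtMost-translate ds j (towerStep∈ds s (0ℤ ℤ.<? ψ s)) (sumsAtMost-1 ds s∈ds)

  φ : V2 → ℤ
  φ = perp a ·_

  φ-tower : ∀ j s → φ (tower j s) ≡ φ s
  φ-tower j s = begin
    φ (tower j s)                             ≡⟨ ·-translate (perp a) j (towerStep s σ) s ⟩
    fold (φ s) (ℤ._+_ (φ (towerStep s σ))) j  ≡⟨ cong (λ c → fold (φ s) (ℤ._+_ c) j) (φ-towerStep σ) ⟩
    fold (φ s) (ℤ._+_ 0ℤ) j                   ≡⟨ fold-+-identity j (φ s) ⟩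
    φ s                                       ∎
    where
    open ≡-Reasoning
    σ : Dec (0ℤ ℤ.< ψ s)
    σ = 0ℤ ℤ.<? ψ s
    φ-towerStep : ∀ τ → φ (towerStep s τ) ≡ 0ℤ
    φ-towerStep (yes _) = perp-·-self a
    φ-towerStep (no _) = trans (·-negV (perp a) a) (cong ℤ.-_ (perp-·-self a))

  opaque
    w : V2
    w = proj₁ (maximiser ℕ.≤-totalOrder (∣_∣ ∘ φ) d∈ds)

    w∈ds : w ∈ ds
    w∈ds = proj₁ (proj₂ (maximiser ℕ.≤-totalOrder (∣_∣ ∘ φ) d∈ds))

    ∣φ∣≤∣φw∣ : ∀ {s} → s ∈ ds → ∣ φ s ∣ ≤ ∣ φ w ∣
    ∣φ∣≤∣φw∣ = proj₂ (proj₂ (maximiser ℕ.≤-totalOrder (∣_∣ ∘ φ) d∈ds))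

  ∣φw∣≢0 : ∣ φ w ∣ ≢ 0
  ∣φw∣≢0 ∣φw∣≡0 = d∦e (perp·≡0⇒Parallel d e a≢0 (φ≡0 d∈ds) (φ≡0 e∈ds))
    where
    φ≡0 : ∀ {s} → s ∈ ds → φ s ≡ 0ℤ
    φ≡0 s∈ds = ℤₚ.∣i∣≡0⇒i≡0 (ℕ.n≤0⇒n≡0 (subst (∣ φ _ ∣ ≤_) ∣φw∣≡0 (∣φ∣≤∣φw∣ s∈ds)))

  extra : ℕ → V2
  extra k = translate (k ∸ 2) a (w +V w)

  extra∈sums : ∀ {k} → 2 ≤ k → extra k ∈ sumsAtMost ds k
  extra∈sums {k} 2≤k = subst (λ r → extra k ∈ sumsAtMost ds r) (ℕ.m∸n+n≡m 2≤k)
    (sumsAtMost-translate ds (k ∸ 2) a∈ds (sumsAtMost-step ds {1} (sumsAtMost-1 ds w∈ds) w∈ds))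

  φ-extra : ∀ k → φ (extra k) ≡ φ w ℤ.+ φ w
  φ-extra k = begin
    φ (extra k)                              ≡⟨ ·-translate (perp a) (k ∸ 2) a (w +V w) ⟩
    fold (φ (w +V w)) (ℤ._+_ (φ a)) (k ∸ 2)  ≡⟨ cong (λ c → fold (φ (w +V w)) (ℤ._+_ c) (k ∸ 2)) (perp-·-self a) ⟩
    fold (φ (w +V w)) (ℤ._+_ 0ℤ) (k ∸ 2)     ≡⟨ fold-+-identity (k ∸ 2) (φ (w +V w)) ⟩
    φ (w +V w)                               ≡⟨ ·-distribˡ-+V (perp a) w w ⟩
    φ w ℤ.+ φ w                              ∎
    where open ≡-Reasoning

  extra-beyond : ∀ k {u} → ∣ φ u ∣ ≤ ∣ φ w ∣ → u ≢ extra k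
  extra-beyond k ∣φu∣≤∣φw∣ refl = ∣φw∣≢0 (ℕ.n≤0⇒n≡0 (ℕ.+-cancelˡ-≤ n n 0 n+n≤n+0))
    where
    n : ℕ
    n = ∣ φ w ∣
    n+n≤n+0 : n + n ≤ n + 0
    n+n≤n+0 = subst₂ _≤_ (trans (cong ∣_∣ (φ-extra k)) (∣i+i∣≡∣i∣+∣i∣ (φ w))) (sym (ℕ.+-identityʳ n))
                         ∣φu∣≤∣φw∣

  extra-nonzero : ∀ k → extra k ≢ 0V
  extra-nonzero k extra≡0 = extra-beyond k ∣φ0∣≤∣φw∣ (sym extra≡0)
    where
    ∣φ0∣≤∣φw∣ : ∣ φ 0V ∣ ≤ ∣ φ w ∣
    ∣φ0∣≤∣φw∣ = subst (_≤ ∣ φ w ∣) (sym (cong ∣_∣ (·-zeroʳ (perp a)))) z≤n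

  towers : ℕ → List V2
  towers k = concatMap (λ j → map (tower j) ds) (upTo k)

  ∈-towers⁻ : ∀ {k u} → u ∈ towers k → ∃₂ λ j s → j < k × s ∈ ds × u ≡ tower j s
  ∈-towers⁻ {k} u∈ with find (∈-concatMap⁻ (λ j → map (tower j) ds) {upTo k} u∈)
  ... | j , j∈ , u∈row with ∈-map⁻ (tower j) u∈row
  ... | s , s∈ds , u≡ = j , s , ∈-upTo⁻ j∈ , s∈ds , u≡

  towers-unique : ∀ k → Unique (towers k)
  towers-unique k = Unique-concatMap⁺ _ (Uniqueₚ.upTo⁺ k)
    (λ {j} _ → Unique-map⁺ (tower j) ds! λ s∈ t∈ eq → proj₂ (tower-injective {j} {j} s∈ t∈ eq))
    λ {j} {j′} _ _ u∈ u∈′ → case ∈-map⁻ (tower j) u∈ , ∈-map⁻ (tower j′) u∈′ of λ where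
      ((s , s∈ds , refl) , (t , t∈ds , eq)) → proj₁ (tower-injective {j} {j′} s∈ds t∈ds eq)

  length-towers : ∀ k → length (towers k) ≡ k * length ds
  length-towers k = trans (length-concatMap-const _ (λ j → length-map (tower j) ds) (upTo k))
                          (cong (_* length ds) (length-upTo k))

  covered : ∀ {k u} → 2 ≤ k → u ∈ extra k ∷ towers k → CoveredBy ds k u
  covered {k} 2≤k (here refl) = extra∈sums 2≤k , extra-nonzero k
  covered {k} 2≤k (there u∈) with ∈-towers⁻ u∈
  ... | j , s , j<k , s∈ds , refl =
    sumsAtMost-mono ds (subst (_≤ k) (ℕ.+-comm 1 j) j<k) (tower∈sums j s∈ds) , tower-nonzero j s∈ds

  extra∉towers : ∀ k → All (extra k ≢_) (towers k)
  extra∉towers k = All.tabulate λ u∈ extra≡u → case ∈-towers⁻ {k} u∈ of λ where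
    (j , s , _ , s∈ds , refl) →
      extra-beyond k (subst (_≤ ∣ φ w ∣) (sym (cong ∣_∣ (φ-tower j s))) (∣φ∣≤∣φw∣ s∈ds)) (sym extra≡u)

  k*|ds|<C : ∀ {k m} → 2 ≤ k → (v : Config m) → ds ⊆ diffs v → k * length ds < C k v
  k*|ds|<C {k} 2≤k v ds⊆diffs =
    subst (λ n → suc n ≤ C k v) (length-towers k)
      (Unique∧⊆⇒length≤ _≟V_ (extra∉towers k ∷ towers-unique k) λ u∈ →
        let u∈S , u≢0 = covered 2≤k u∈ in
        ∈-deduplicate⁺ _≟V_
          (∈-filter⁺ (λ u → ¬? (u ≟V 0V)) (sumsAtMost-⊆ {ds} k ds⊆diffs u∈S) u≢0))

lemma3 : (k : ℕ) → 2 ≤ k → (m : ℕ) → (D : Config m) → IsDD D →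
    HasNonParallelDiffs D → k * m * (m ∸ 1) < C k D
lemma3 k 2≤k m D dd (i , j , i′ , j′ , i≢j , i′≢j′ , d∦d′) =
  subst (_< C k D) k·|differences|≡ (k*|ds|<C 2≤k D (differences⊆diffs D))
  where
  open Coverage (differences D) (differences-unique D dd) (0∉differences D dd) (differences-negV D)
                (∈-differences⁺ D i≢j) (∈-differences⁺ D i′≢j′) d∦d′
  k·|differences|≡ : k * length (differences D) ≡ k * m * (m ∸ 1)
  k·|differences|≡ = trans (cong (k *_) (length-differences D)) (sym (ℕ.*-assoc k m (m ∸ 1)))
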